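{- Let $\ell \in \mathbb{N}$, let $G$ be a $2$-connected graph that is $k$-contractible to a graph $T \in \mathbb{T}_\ell$, let $\mathcal{W}$ be a $T$-witness structure of $G$, let $\phi: V(G) \to [2\sqrt{\ell}+2]$ be a $\mathcal{W}$-compatible coloring, and let $\mathcal{X}$ be the set of monochromatic components of $\phi$. Let $X \in \mathcal{X}$ with $|X| \ge 2$, and let $\mathcal{W}_X \subseteq \mathcal{W}$ be such that $X = \bigcup_{Y \in \mathcal{W}_X} Y$. Suppose that: $G[X]$ is an induced path $(u, v_1, \dots, v_q, v)$ for some $q \in \mathbb{N}$; $\deg_G(v_i) = 2$ for every $i \in [q]$; and there exists $X' \in \mathcal{X}\setminus\{X\}$ with $N(u)\cap X' \ne \emptyset$ and $N(v)\cap X' \ne \emptyset$. Then $|\mathcal{W}_X| = 1$.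
   Context: All graphs are finite and simple. For $\ell \in \mathbb{N}$, $\mathbb{T}_\ell$ is the class of graphs from which a tree can be obtained by deleting at most $\ell$ edges. $G$ is $k$-contractible to $H$ if $G/S$ is isomorphic to $H$ for some $S \subseteq E(G)$ with $|S| \le k$. An $H$-witness structure of $G$ is a partition $\{W(h) : h \in V(H)\}$ of $V(G)$ with each $G[W(h)]$ connected and $hh' \in E(H)$ iff some edge of $G$ joins $W(h)$ and $W(h')$. Given such $T$ and $\mathcal{W}$, fix a spanning tree $T_S$ of $T$; let $M$ be the set of endpoints of edges in $E(T)\setminus E(T_S)$ together with all vertices of degree at least $3$ in $T$, and $B = \{t \in V(T) : |W(t)| \ge 2\}$. A coloring $\phi$ of $V(G)$ is $\mathcal{W}$-compatible if: (1) every witness set is monochromatic; (2) for all adjacent $t,t' \in M\cup B$, $\phi(W(t)) \ne \phi(W(t'))$; (3) for all $t,t' \in M \cup B$ (not necessarily distinct) and every path $(t,t_1,\dots,t_z,t')$ in $T$ with $z\ge 1$ and $t_i \notin M\cup B$ for all $i$, $\phi(W(t)) \ne \phi(W(t_1))$ and $\phi(W(t_z)) \ne \phi(W(t'))$. The monochromatic components of $\phi$ are the vertex sets of the connected components of $G[\phi^{ -1}(c)]$, over all colors $c$. $[2\sqrt{\ell}+2]$ denotes a set of $2\sqrt{\ell}+2$ colors. -}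

module Defs where

open import Data.Nat using (ℕ; zero; suc; _+_; _*_; _≤_; _<_; _<ᵇ_)
open import Data.Fin using (Fin; zero; suc; toℕ; fromℕ; inject₁; _≟_)
open import Data.Bool using (Bool; true; false; if_then_else_; _∧_; not)
open import Data.Product using (Σ; ∃; _×_; _,_)
open import Data.Sum using (_⊎_)
open import Data.List using (List; length)
open import Data.List.Membership.Propositional using (_∈_)
open import Relation.Nullary using (¬_)
open import Relation.Nullary.Decidable using (⌊_⌋)
open import Relation.Binary.PropositionalEquality using (_≡_; _≢_)
open import Function.Bundles using (_⇔_)

record Graph (n : ℕ) : Set where
  field
    adj    : Fin n → Fin n → Bool
    sym    : ∀ i j → adj i j ≡ adj j i
    irrefl : ∀ i → adj i i ≡ false
open Graph public

Edge : ∀ {n} → Graph n → Fin n → Fin n → Set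
Edge G i j = adj G i j ≡ true

VSet : ℕ → Set
VSet n = Fin n → Bool

_∈ˢ_ : ∀ {n} → Fin n → VSet n → Set
x ∈ˢ S = S x ≡ true

allV : ∀ {n} → VSet n
allV _ = true

count : ∀ {n} → VSet n → ℕ
count {zero}  f = 0
count {suc n} f = (if f zero then 1 else 0) + count (λ i → f (suc i))

deg : ∀ {n} → Graph n → Fin n → ℕ
deg G v = count (adj G v)

data Reach {n} (G : Graph n) (S : VSet n) : Fin n → Fin n → Set where
  here : ∀ {x} → x ∈ˢ S → Reach G S x x
  step : ∀ {x y z} → x ∈ˢ S → Edge G x y → Reach G S y z → Reach G S x z

Connected : ∀ {n} → Graph n → VSet n → Set
Connected G S = (∃ λ x → x ∈ˢ S) × (∀ x y → x ∈ˢ S → y ∈ˢ S → Reach G S x y)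

-- 2-connected: at least 3 vertices, and G - X connected whenever |X| < 2
TwoConnected : ∀ {n} → Graph n → Set
TwoConnected {n} G =
  (3 ≤ n) × Connected G allV × (∀ v → Connected G (λ x → not ⌊ x ≟ v ⌋))

HasCycle : ∀ {n} → Graph n → Set
HasCycle {n} G = Σ ℕ λ k → Σ (Fin (3 + k) → Fin n) λ c →
  (∀ i j → c i ≡ c j → i ≡ j) ×
  (∀ i j → suc (toℕ i) ≡ toℕ j → Edge G (c i) (c j)) ×
  Edge G (c (fromℕ (2 + k))) (c zero)

IsTree : ∀ {n} → Graph n → Set
IsTree G = Connected G allV × ¬ HasCycle G

SpanningSub : ∀ {n} → Graph n → Graph n → Set
SpanningSub H G = ∀ i j → Edge H i j → Edge G i j

sumF : ∀ {n} → (Fin n → ℕ) → ℕ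
sumF {zero}  f = 0
sumF {suc n} f = f zero + sumF (λ i → f (suc i))

deletedEdges : ∀ {n} → Graph n → Graph n → ℕ
deletedEdges G H =
  sumF (λ i → count (λ j → (toℕ i <ᵇ toℕ j) ∧ adj G i j ∧ not (adj H i j)))

-- T ∈ 𝕋_ℓ : deleting at most ℓ edges of T yields a tree
InTreeClass : ∀ {n} → ℕ → Graph n → Set
InTreeClass {n} ℓ T = Σ (Graph n) λ T′ →
  SpanningSub T′ T × IsTree T′ × deletedEdges T T′ ≤ ℓ

data SReach {n} (S : List (Fin n × Fin n)) : Fin n → Fin n → Set where
  here : ∀ {x} → SReach S x x
  step : ∀ {x y z} → ((x , y) ∈ S ⊎ (y , x) ∈ S) → SReach S y z → SReach S x z

-- G / S ≅ H : witnessed by the quotient map f : V(G) → V(H), whose fibres are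
-- exactly the classes of the equivalence generated by S, and two vertices of H
-- are adjacent iff they are distinct classes joined by an edge of G.
ContractsTo : ∀ {n m} → Graph n → List (Fin n × Fin n) → Graph m → Set
ContractsTo {n} {m} G S H = Σ (Fin n → Fin m) λ f →
  (∀ h → ∃ λ x → f x ≡ h) ×
  (∀ x y → (f x ≡ f y) ⇔ SReach S x y) ×
  (∀ h h′ → Edge H h h′ ⇔ ((h ≢ h′) × ∃ λ x → ∃ λ y → f x ≡ h × f y ≡ h′ × Edge G x y))

KContractible : ∀ {n m} → ℕ → Graph n → Graph m → Set
KContractible {n} k G H = Σ (List (Fin n × Fin n)) λ S →
  length S ≤ k × (∀ x y → (x , y) ∈ S → Edge G x y) × ContractsTo G S H

-- Witness structures: the partition {W(h)} is given by w : V(G) → V(H),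
-- W(h) = w⁻¹(h).

fibre : ∀ {n m} → (Fin n → Fin m) → Fin m → VSet n
fibre w h x = ⌊ w x ≟ h ⌋

WitnessStructure : ∀ {n m} → Graph n → Graph m → (Fin n → Fin m) → Set
WitnessStructure G H w =
  (∀ h → Connected G (fibre w h)) ×
  (∀ h h′ → Edge H h h′ ⇔ ((h ≢ h′) × ∃ λ x → ∃ λ y → w x ≡ h × w y ≡ h′ × Edge G x y))

InM : ∀ {m} → Graph m → Graph m → Fin m → Set
InM T TS t = (∃ λ t′ → Edge T t t′ × adj TS t t′ ≡ false) ⊎ (3 ≤ deg T t)

InB : ∀ {n m} → (Fin n → Fin m) → Fin m → Set
InB w t = 2 ≤ count (fibre w t)

InMB : ∀ {n m} → Graph m → Graph m → (Fin n → Fin m) → Fin m → Set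
InMB T TS w t = InM T TS t ⊎ InB w t

DiffColour : ∀ {n m c} → (Fin n → Fin m) → (Fin n → Fin c) → Fin m → Fin m → Set
DiffColour w φ t t′ = ∀ a b → w a ≡ t → w b ≡ t′ → φ a ≢ φ b

Compatible : ∀ {n m c} → Graph m → Graph m → (Fin n → Fin m) → (Fin n → Fin c) → Set
Compatible {n} {m} T TS w φ =
  -- (1) witness sets are monochromatic
  (∀ a b → w a ≡ w b → φ a ≡ φ b) ×
  -- (2) adjacent t, t′ ∈ M ∪ B get different colours
  (∀ t t′ → Edge T t t′ → InMB T TS w t → InMB T TS w t′ → DiffColour w φ t t′) ×
  -- (3) paths (t, s₀, …, s_z, t′) in T with interior outside M ∪ B
  --     (t = t′ allowed, in which case the path is a cycle, so it has ≥ 2 interior vertices)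
  (∀ t t′ z (s : Fin (suc z) → Fin m) →
     InMB T TS w t → InMB T TS w t′ →
     (∀ i j → s i ≡ s j → i ≡ j) →
     (∀ i → ¬ InMB T TS w (s i)) →
     Edge T t (s zero) →
     (∀ i j → suc (toℕ i) ≡ toℕ j → Edge T (s i) (s j)) →
     Edge T (s (fromℕ z)) t′ →
     (t ≡ t′ → 1 ≤ z) →
     DiffColour w φ t (s zero) × DiffColour w φ (s (fromℕ z)) t′)

_⊆ˢ_ : ∀ {n} → VSet n → VSet n → Set
X ⊆ˢ Y = ∀ x → x ∈ˢ X → x ∈ˢ Y

MonoComponent : ∀ {n c} → Graph n → (Fin n → Fin c) → VSet n → Set
MonoComponent {n} {c} G φ X = Σ (Fin c) λ col →
  (∀ x → x ∈ˢ X → φ x ≡ col) ×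
  Connected G X ×
  (∀ (Y : VSet n) → X ⊆ˢ Y → (∀ x → x ∈ˢ Y → φ x ≡ col) → Connected G Y → Y ⊆ˢ X)

-- G[X] is an induced path p₀ p₁ … p_{q+1}  (u = p₀, v = p_{q+1})
IsInducedPath : ∀ {n} → Graph n → VSet n → (q : ℕ) → (Fin (2 + q) → Fin n) → Set
IsInducedPath G X q p =
  (∀ i j → p i ≡ p j → i ≡ j) ×
  (∀ x → x ∈ˢ X ⇔ (∃ λ i → p i ≡ x)) ×
  (∀ i j → Edge G (p i) (p j) ⇔ (suc (toℕ i) ≡ toℕ j ⊎ suc (toℕ j) ≡ toℕ i))

module Submission where

-- Let X be a monochromatic component (colour d) that induces the path u = p₀ … p_{q+1} = v,
-- and X′ ≠ X a monochromatic component (colour d′) with neighbours u′ of u and v′ of v.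
--
--  * X and X′ are adjacent, so by maximality of components d ≠ d′.
--  * W(u) = W(v).  Otherwise, projecting a u–v walk in G[X] and a v′–u′ walk in G[X′] to T
--    gives simple paths of colours d and d′ which, with the edges W(v)W(v′) and W(u′)W(u),
--    close a cycle of T.  It cannot lie in the tree T_S, and the two ways of leaving T_S both
--    violate compatibility: a non-tree edge inside one colour joins two equally coloured
--    vertices of M (rule (2)); a non-tree link edge makes its ends M-vertices, and walking
--    from one end around the cycle to the other, the first step keeps the colour although
--    rules (2)/(3) forbid this.
--  * W(u) ⊆ X by maximality, and a connected subset of an induced path containing both
--    ends is the whole path; hence X ⊆ W(u), i.e. A = {W(u)}.

open import Defs
open import Data.Nat using (ℕ; zero; suc; pred; _+_; _*_; _≤_; _<_; _≤?_; z≤n; s≤s)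
import Data.Nat.Properties as ℕ
open import Data.Fin using (Fin; zero; suc; toℕ; fromℕ; inject₁; _≟_)
import Data.Fin.Properties as Fin
open import Data.Bool using (true; false; _∨_)
import Data.Bool.Properties as Bool
open import Data.Product using (Σ; ∃; ∃₂; _×_; _,_; proj₁; proj₂)
open import Data.Sum using (_⊎_; inj₁; inj₂; [_,_]′)
open import Data.Empty using (⊥; ⊥-elim)
open import Data.List using (List; []; _∷_; _++_; _∷ʳ_; length; lookup)
open import Data.List.Relation.Unary.All as All using (All; []; _∷_)
import Data.List.Relation.Unary.All.Properties as All
open import Data.List.Relation.Unary.Any using (Any; here; there)
open import Data.List.Relation.Unary.AllPairs using ([]; _∷_)
open import Data.List.Relation.Unary.Unique.Propositional using (Unique)
import Data.List.Relation.Unary.Unique.Propositional.Properties as Unique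
open import Data.List.Relation.Binary.Disjoint.Propositional using (Disjoint)
open import Data.List.Membership.Propositional using (_∈_; lose)
open import Data.List.Membership.Propositional.Properties using (∈-++⁺ʳ; ∈-lookup)
open import Relation.Nullary using (¬_; Dec; yes; no)
open import Relation.Unary using (Decidable)
open import Relation.Nullary.Decidable using (_×-dec_; _⊎-dec_)
open import Relation.Binary.PropositionalEquality as ≡ using (_≡_; _≢_; refl; trans; cong; subst; subst₂)
open import Function.Base using (_∘_)
open import Function.Bundles using (_⇔_; Equivalence; mk⇔)

_∪ˢ_ : ∀ {n} → VSet n → VSet n → VSet n
(S ∪ˢ S′) x = S x ∨ S′ x

∪-⊆ˡ : ∀ {n} (S S′ : VSet n) → S ⊆ˢ (S ∪ˢ S′)
∪-⊆ˡ S S′ x x∈S rewrite x∈S = refl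

∪-⊆ʳ : ∀ {n} (S S′ : VSet n) → S′ ⊆ˢ (S ∪ˢ S′)
∪-⊆ʳ S S′ x x∈S′ rewrite x∈S′ = Bool.∨-zeroʳ (S x)

∪-elim : ∀ {n} (S S′ : VSet n) {x} → x ∈ˢ (S ∪ˢ S′) → x ∈ˢ S ⊎ x ∈ˢ S′
∪-elim S S′ {x} x∈S∪S′ with S x
... | true  = inj₁ refl
... | false = inj₂ x∈S∪S′

⊆-antisym : ∀ {n} {S S′ : VSet n} → S ⊆ˢ S′ → S′ ⊆ˢ S → ∀ x → S x ≡ S′ x
⊆-antisym {S = S} {S′} S⊆S′ S′⊆S x with S x in eS | S′ x in eS′
... | true  | true  = refl
... | false | false = refl
... | true  | false = trans (≡.sym (S⊆S′ x eS)) eS′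
... | false | true  = trans (≡.sym eS) (S′⊆S x eS′)

fibre-⇔ : ∀ {n m} (w : Fin n → Fin m) {t x} → x ∈ˢ fibre w t ⇔ w x ≡ t
fibre-⇔ w {t} {x} = mk⇔ to from
  where
  to : x ∈ˢ fibre w t → w x ≡ t
  to x∈W with w x ≟ t
  ... | yes wx≡t = wx≡t
  to () | no _
  from : w x ≡ t → x ∈ˢ fibre w t
  from wx≡t with w x ≟ t
  ... | yes _    = refl
  ... | no wx≢t = ⊥-elim (wx≢t wx≡t)

count-empty : ∀ {n} (S : VSet n) → (∀ x → ¬ x ∈ˢ S) → count S ≡ 0
count-empty {zero}  S empty = refl
count-empty {suc n} S empty with S zero in e
... | true  = ⊥-elim (empty zero e)
... | false = count-empty (λ x → S (suc x)) (λ x → empty (suc x))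

count-singleton : ∀ {n} (S : VSet n) a → a ∈ˢ S → (∀ x → x ∈ˢ S → x ≡ a) → count S ≡ 1
count-singleton {suc n} S zero a∈S only rewrite a∈S =
  cong suc (count-empty _ (λ x x∈S → Fin.0≢1+n (≡.sym (only (suc x) x∈S))))
count-singleton {suc n} S (suc a) a∈S only with S zero in e
... | true  = ⊥-elim (Fin.0≢1+n (only zero e))
... | false = count-singleton (λ x → S (suc x)) a a∈S (λ x x∈S → Fin.suc-injective (only (suc x) x∈S))

edge-sym : ∀ {n} (G : Graph n) {x y} → Edge G x y → Edge G y x
edge-sym G {x} {y} e = trans (Graph.sym G y x) e

module _ {n} {G : Graph n} where

  reach-start : ∀ {S x y} → Reach G S x y → x ∈ˢ S
  reach-start (here x∈S)     = x∈S
  reach-start (step x∈S _ _) = x∈S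

  reach-mono : ∀ {S S′ x y} → S ⊆ˢ S′ → Reach G S x y → Reach G S′ x y
  reach-mono S⊆S′ (here x∈S)          = here (S⊆S′ _ x∈S)
  reach-mono S⊆S′ (step x∈S e walk) = step (S⊆S′ _ x∈S) e (reach-mono S⊆S′ walk)

  reach-trans : ∀ {S x y z} → Reach G S x y → Reach G S y z → Reach G S x z
  reach-trans (here _)            walk′ = walk′
  reach-trans (step x∈S e walk) walk′ = step x∈S e (reach-trans walk walk′)

  ∪-connected : ∀ {S S′ a b} → Connected G S → Connected G S′ → a ∈ˢ S → b ∈ˢ S′ →
                a ≡ b ⊎ Edge G a b → Connected G (S ∪ˢ S′)
  ∪-connected {S} {S′} {a} {b} (_ , S-conn) (_ , S′-conn) a∈S b∈S′ link =
    (a , ∪-⊆ˡ S S′ a a∈S) , connect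
    where
    inˡ : ∀ {x y} → Reach G S x y → Reach G (S ∪ˢ S′) x y
    inˡ = reach-mono (∪-⊆ˡ S S′)
    inʳ : ∀ {x y} → Reach G S′ x y → Reach G (S ∪ˢ S′) x y
    inʳ = reach-mono (∪-⊆ʳ S S′)
    a↝b : Reach G (S ∪ˢ S′) a b
    a↝b = [ (λ a≡b → subst (Reach G _ a) a≡b (inˡ (here a∈S)))
          , (λ e → step (∪-⊆ˡ S S′ a a∈S) e (inʳ (here b∈S′))) ]′ link
    b↝a : Reach G (S ∪ˢ S′) b a
    b↝a = [ (λ a≡b → subst (λ y → Reach G _ y a) a≡b (inˡ (here a∈S)))
          , (λ e → step (∪-⊆ʳ S S′ b b∈S′) (edge-sym G e) (inˡ (here a∈S))) ]′ link
    connect : ∀ x y → x ∈ˢ (S ∪ˢ S′) → y ∈ˢ (S ∪ˢ S′) → Reach G (S ∪ˢ S′) x y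
    connect x y x∈ y∈ with ∪-elim S S′ x∈ | ∪-elim S S′ y∈
    ... | inj₁ x∈S  | inj₁ y∈S  = inˡ (S-conn x y x∈S y∈S)
    ... | inj₂ x∈S′ | inj₂ y∈S′ = inʳ (S′-conn x y x∈S′ y∈S′)
    ... | inj₁ x∈S  | inj₂ y∈S′ =
      reach-trans (inˡ (S-conn x a x∈S a∈S)) (reach-trans a↝b (inʳ (S′-conn b y b∈S′ y∈S′)))
    ... | inj₂ x∈S′ | inj₁ y∈S  =
      reach-trans (inʳ (S′-conn x b x∈S′ b∈S′)) (reach-trans b↝a (inˡ (S-conn a y a∈S y∈S)))

Monochromatic : ∀ {n c} → (Fin n → Fin c) → VSet n → Fin c → Set
Monochromatic φ S d = ∀ x → x ∈ˢ S → φ x ≡ d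

module _ {n c} {G : Graph n} {φ : Fin n → Fin c} where

  absorb : ∀ {X Y a b} (cX : MonoComponent G φ X) → Connected G Y →
           Monochromatic φ Y (proj₁ cX) → a ∈ˢ X → b ∈ˢ Y → a ≡ b ⊎ Edge G a b → Y ⊆ˢ X
  absorb {X} {Y} (d , X-mono , X-conn , X-max) Y-conn Y-mono a∈X b∈Y link y y∈Y =
    X-max (X ∪ˢ Y) (∪-⊆ˡ X Y) ∪-mono (∪-connected X-conn Y-conn a∈X b∈Y link) y (∪-⊆ʳ X Y y y∈Y)
    where
    ∪-mono : Monochromatic φ (X ∪ˢ Y) d
    ∪-mono x x∈ with ∪-elim X Y x∈
    ... | inj₁ x∈X = X-mono x x∈X
    ... | inj₂ x∈Y = Y-mono x x∈Y

  adjacent-components-differ : ∀ {X X′ a b} (cX : MonoComponent G φ X) (cX′ : MonoComponent G φ X′) →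
    ¬ (∀ x → X x ≡ X′ x) → a ∈ˢ X → b ∈ˢ X′ → Edge G a b → proj₁ cX ≢ proj₁ cX′
  adjacent-components-differ cX@(_ , X-mono , X-conn , _) cX′@(_ , X′-mono , X′-conn , _)
                             X≢X′ a∈X b∈X′ e refl =
    X≢X′ (⊆-antisym (absorb cX′ X-conn X-mono b∈X′ a∈X (inj₂ (edge-sym G e)))
                    (absorb cX X′-conn X′-mono a∈X b∈X′ (inj₂ e)))

  witness-set-in-component : ∀ {m} {T : Graph m} {w : Fin n → Fin m} {X x} →
    WitnessStructure G T w → (∀ a b → w a ≡ w b → φ a ≡ φ b) →
    MonoComponent G φ X → x ∈ˢ X → fibre w (w x) ⊆ˢ X
  witness-set-in-component {w = w} {x = x} WS φ-const cX@(_ , X-mono , _) x∈X =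
    absorb cX (proj₁ WS (w x)) W-mono x∈X (Equivalence.from (fibre-⇔ w) refl) (inj₁ refl)
    where
    W-mono : Monochromatic φ (fibre w (w x)) (proj₁ cX)
    W-mono y y∈W = trans (φ-const y x (Equivalence.to (fibre-⇔ w) y∈W)) (X-mono x x∈X)

module _ {n q} {G : Graph n} {X : VSet n} {p : Fin (2 + q) → Fin n} (X-path : IsInducedPath G X q p) where

  private
    p-injective = proj₁ X-path
    X-is-p      = proj₁ (proj₂ X-path)
    p-edges     = proj₂ (proj₂ X-path)

  -- A walk inside S ⊆ X from p j to p k visits every p i with j ≤ i ≤ k, because
  -- consecutive vertices of the walk have consecutive indices.
  walk-covers-interval : ∀ {S} → S ⊆ˢ X → ∀ {x y} → Reach G S x y →
    ∀ {i j k} → p j ≡ x → p k ≡ y → toℕ j ≤ toℕ i → toℕ i ≤ toℕ k → p i ∈ˢ S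
  walk-covers-interval {S} S⊆X (here x∈S) {i} {j} {k} pj≡x pk≡x j≤i i≤k
    with refl ← p-injective j k (trans pj≡x (≡.sym pk≡x)) =
    subst (_∈ˢ S) (≡.sym (trans (cong p (Fin.toℕ-injective (ℕ.≤-antisym i≤k j≤i))) pj≡x)) x∈S
  walk-covers-interval {S} S⊆X (step {y = x₁} x∈S e walk) {i} {j} pj≡x pk≡y j≤i i≤k
    with toℕ j ℕ.≟ toℕ i
  ... | yes j≡i =
    subst (_∈ˢ S) (≡.sym (trans (cong p (Fin.toℕ-injective (≡.sym j≡i))) pj≡x)) x∈S
  ... | no j≢i with Equivalence.to (X-is-p x₁) (S⊆X x₁ (reach-start walk))
  ...   | j₁ , pj₁≡x₁ with Equivalence.to (p-edges j j₁) (subst₂ (Edge G) (≡.sym pj≡x) (≡.sym pj₁≡x₁) e)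
  ...     | inj₁ forward =
    walk-covers-interval S⊆X walk pj₁≡x₁ pk≡y (subst (_≤ toℕ i) forward (ℕ.≤∧≢⇒< j≤i j≢i)) i≤k
  ...     | inj₂ backward =
    walk-covers-interval S⊆X walk pj₁≡x₁ pk≡y
      (ℕ.≤-trans (ℕ.n≤1+n (toℕ j₁)) (subst (_≤ toℕ i) (≡.sym backward) j≤i)) i≤k

  connected-through-ends : ∀ {S} → S ⊆ˢ X → Connected G S →
    p zero ∈ˢ S → p (fromℕ (suc q)) ∈ˢ S → X ⊆ˢ S
  connected-through-ends S⊆X (_ , S-conn) first∈S last∈S x x∈X
    with Equivalence.to (X-is-p x) x∈X
  ... | i , refl =
    walk-covers-interval S⊆X (S-conn _ _ first∈S last∈S) refl refl z≤n
      (subst (toℕ i ≤_) (≡.sym (Fin.toℕ-fromℕ (suc q))) (Fin.toℕ≤pred[n] i))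

module _ {A : Set} where

  -- Path R x y L: an R-walk that starts at x and then visits the vertices of L, ending at y.
  infixr 5 _∷ᵖ_
  data Path (R : A → A → Set) : A → A → List A → Set where
    []ᵖ  : ∀ {x} → Path R x x []
    _∷ᵖ_ : ∀ {x y z L} → R x y → Path R y z L → Path R x z (y ∷ L)

  module _ {R : A → A → Set} where

    path-end-∈ : ∀ {x y L} → Path R x y L → y ∈ x ∷ L
    path-end-∈ []ᵖ       = here refl
    path-end-∈ (_ ∷ᵖ p) = there (path-end-∈ p)

    path-++ : ∀ {x y a z L M} → Path R x y L → R y a → Path R a z M → Path R x z (L ++ a ∷ M)
    path-++ []ᵖ       r q = r ∷ᵖ q
    path-++ (r′ ∷ᵖ p) r q = r′ ∷ᵖ path-++ p r q

    path-init : ∀ {x y} I → Path R x y (I ∷ʳ y) → ∃ λ e → Path R x e I × R e y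
    path-init []      (r ∷ᵖ []ᵖ) = _ , []ᵖ , r
    path-init (_ ∷ I) (r ∷ᵖ p) with path-init I p
    ... | e , q , r′ = e , r ∷ᵖ q , r′

    path-suffix : ∀ {P : A → Set} {a z t L} → Path R a z L → t ∈ a ∷ L →
      Unique (a ∷ L) → All P (a ∷ L) → ∃ λ L′ → Path R t z L′ × Unique (t ∷ L′) × All P (t ∷ L′)
    path-suffix p        (here refl) simple all-P = _ , p , simple , all-P
    path-suffix (_ ∷ᵖ p) (there t∈L) (_ ∷ simple) (_ ∷ all-P) = path-suffix p t∈L simple all-P

    first-hit : ∀ {P : A → Set} {x z L} → Decidable P → Path R x z L → Any P L →
      ∃₂ λ y I → P y × All (λ a → ¬ P a) I × Path R x y (I ∷ʳ y) × ∃ λ rest → L ≡ I ++ y ∷ rest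
    first-hit P? (r ∷ᵖ p) (here Py) = _ , [] , Py , [] , r ∷ᵖ []ᵖ , _ , refl
    first-hit P? (_∷ᵖ_ {y = y} r p) (there hit) with P? y
    ... | yes Py = _ , [] , Py , [] , r ∷ᵖ []ᵖ , _ , refl
    ... | no ¬Py with first-hit P? p hit
    ...   | _ , I , Py′ , I-free , q , _ , refl = _ , y ∷ I , Py′ , ¬Py ∷ I-free , r ∷ᵖ q , _ , refl

    path-escape : ∀ {R′ : A → A → Set} {x y L} → (∀ a b → Dec (R′ a b)) → Path R x y L →
      Path R′ x y L ⊎ ∃₂ λ a b → a ∈ x ∷ L × b ∈ x ∷ L × R a b × ¬ R′ a b
    path-escape R′? []ᵖ = inj₁ []ᵖ
    path-escape R′? (_∷ᵖ_ {x} {y} r p) with R′? x y | path-escape R′? p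
    ... | no ¬r′ | _      = inj₂ (x , y , here refl , there (here refl) , r , ¬r′)
    ... | yes r′ | inj₁ p′ = inj₁ (r′ ∷ᵖ p′)
    ... | yes _  | inj₂ (a , b , a∈ , b∈ , rab , ¬r′ab) = inj₂ (a , b , there a∈ , there b∈ , rab , ¬r′ab)

    path-lookup-step : ∀ {x y L} → Path R x y L →
      ∀ i j → suc (toℕ i) ≡ toℕ j → R (lookup (x ∷ L) i) (lookup (x ∷ L) j)
    path-lookup-step []ᵖ       zero    zero    ()
    path-lookup-step (r ∷ᵖ p) zero    (suc zero)    _  = r
    path-lookup-step (r ∷ᵖ p) zero    (suc (suc j)) ()
    path-lookup-step (r ∷ᵖ p) (suc i) (suc j) i+1≡j = path-lookup-step p i j (cong pred i+1≡j)

    path-lookup-last : ∀ {x y L} → Path R x y L → lookup (x ∷ L) (fromℕ (length L)) ≡ y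
    path-lookup-last []ᵖ       = refl
    path-lookup-last (_ ∷ᵖ p) = path-lookup-last p

    extended-path-length : ∀ {x y L z M} → Path R x y L → x ≢ y → 2 ≤ length (L ++ z ∷ M)
    extended-path-length []ᵖ                  x≢x = ⊥-elim (x≢x refl)
    extended-path-length (_ ∷ᵖ []ᵖ)          _   = s≤s (s≤s z≤n)
    extended-path-length (_ ∷ᵖ (_ ∷ᵖ _)) _   = s≤s (s≤s z≤n)

  unique-++⁻ˡ : ∀ xs {ys : List A} → Unique (xs ++ ys) → Unique xs
  unique-++⁻ˡ []       _              = []
  unique-++⁻ˡ (x ∷ xs) (x∉ ∷ simple) = All.++⁻ˡ xs x∉ ∷ unique-++⁻ˡ xs simple

  lookup-injective : ∀ {xs : List A} → Unique xs → ∀ i j → lookup xs i ≡ lookup xs j → i ≡ j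
  lookup-injective (_ ∷ _)       zero    zero    _  = refl
  lookup-injective (x∉ ∷ _)      zero    (suc j) eq = ⊥-elim (All.lookup x∉ (∈-lookup j) eq)
  lookup-injective (x∉ ∷ _)      (suc i) zero    eq = ⊥-elim (All.lookup x∉ (∈-lookup i) (≡.sym eq))
  lookup-injective (_ ∷ simple) (suc i) (suc j) eq = cong suc (lookup-injective simple i j eq)

closed-path-cycle : ∀ {n} {H : Graph n} {x y L} → Path (Edge H) x y L → Unique (x ∷ L) →
  2 ≤ length L → Edge H y x → HasCycle H
closed-path-cycle {H = H} {L = l₁ ∷ l₂ ∷ rest} p simple _ yx =
  length rest , lookup (_ ∷ l₁ ∷ l₂ ∷ rest) , lookup-injective simple , path-lookup-step p ,
  subst₂ (Edge H) (≡.sym (path-lookup-last p)) refl yx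
closed-path-cycle {L = _ ∷ []} _ _ (s≤s ()) _

module WitnessColouring {nG nT c} {G : Graph nG} {T TS : Graph nT}
  {w : Fin nG → Fin nT} {φ : Fin nG → Fin c}
  (WS : WitnessStructure G T w) (compatible : Compatible T TS w φ) where

  open import Data.List.Membership.DecPropositional (_≟_ {nT}) using (_∈?_)

  MB : Fin nT → Set
  MB = InMB T TS w

  witness-monochromatic : ∀ a b → w a ≡ w b → φ a ≡ φ b
  witness-monochromatic = proj₁ compatible

  adjacent-rule : ∀ t t′ → Edge T t t′ → MB t → MB t′ → DiffColour w φ t t′
  adjacent-rule = proj₁ (proj₂ compatible)

  Coloured : Fin c → Fin nT → Set
  Coloured d t = ∃ λ g → w g ≡ t × φ g ≡ d

  colour-unique : ∀ {d d′ t} → Coloured d t → Coloured d′ t → d ≡ d′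
  colour-unique (g , wg , φg) (h , wh , φh) =
    trans (≡.sym φg) (trans (witness-monochromatic g h (trans wg (≡.sym wh))) φh)

  colours-disjoint : ∀ {d d′ L M} → d ≢ d′ → All (Coloured d) L → All (Coloured d′) M → Disjoint L M
  colours-disjoint d≢d′ L-col M-col (v∈L , v∈M) =
    d≢d′ (colour-unique (All.lookup L-col v∈L) (All.lookup M-col v∈M))

  clash : ∀ {d a b} → DiffColour w φ a b → Coloured d a → Coloured d b → ⊥
  clash differ (g , wg , φg) (h , wh , φh) = differ g h wg wh (trans φg (≡.sym φh))

  adjacent-MB-differ : ∀ {d a b} → Edge T a b → MB a → MB b → Coloured d a → Coloured d b → ⊥
  adjacent-MB-differ e a∈MB b∈MB = clash (adjacent-rule _ _ e a∈MB b∈MB)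

  non-tree-edge-in-M : ∀ {a b} → Edge T a b → adj TS a b ≡ false → MB a × MB b
  non-tree-edge-in-M {a} {b} e ∉TS =
    inj₁ (inj₁ (b , e , ∉TS)) , inj₁ (inj₁ (a , edge-sym T e , trans (Graph.sym TS b a) ∉TS))

  MB? : Decidable MB
  MB? t = (Fin.any? (λ t′ → (adj T t t′ Bool.≟ true) ×-dec (adj TS t t′ Bool.≟ false))
           ⊎-dec (3 ≤? deg T t))
          ⊎-dec (2 ≤? count (fibre w t))

  witness-edge : ∀ {x y} → Edge G x y → w x ≢ w y → Edge T (w x) (w y)
  witness-edge {x} {y} e wx≢wy =
    Equivalence.from (proj₂ WS (w x) (w y)) (wx≢wy , x , y , refl , refl , e)

  recoloured-edge : ∀ {x y} → Edge G x y → φ x ≢ φ y → Edge T (w x) (w y)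
  recoloured-edge {x} {y} e φx≢φy = witness-edge e (λ wx≡wy → φx≢φy (witness-monochromatic x y wx≡wy))

  record ColouredPath (d : Fin c) (a b : Fin nT) : Set where
    constructor colouredPath
    field
      vertices : List (Fin nT)
      path     : Path (Edge T) a b vertices
      simple   : Unique (a ∷ vertices)
      coloured : All (Coloured d) (a ∷ vertices)
  open ColouredPath

  project : ∀ {S d x y} → Reach G S x y → Monochromatic φ S d → ColouredPath d (w x) (w y)
  project {x = x} (here x∈S) S-mono =
    colouredPath [] []ᵖ ([] ∷ []) ((x , refl , S-mono x x∈S) ∷ [])
  project {x = x} (step x∈S e walk) S-mono with project walk S-mono
  ... | colouredPath L P P-simple P-col with w x ∈? (_ ∷ L)
  ...   | yes wx∈ = let L′ , P′ , P′-simple , P′-col = path-suffix P wx∈ P-simple P-col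
                    in colouredPath L′ P′ P′-simple P′-col
  ...   | no wx∉ =
    colouredPath (_ ∷ L) (witness-edge e (λ wx≡ → wx∉ (here wx≡)) ∷ᵖ P)
      (All.¬Any⇒All¬ _ wx∉ ∷ P-simple) ((x , refl , S-mono x x∈S) ∷ P-col)

  -- Cut the path at its next vertex y in M ∪ B: if y is the
  -- first step, rule (2) applies, otherwise rule (3) to the stretch before y.
  first-step-recoloured : ∀ {d t r z L} → MB t → Path (Edge T) t z (r ∷ L) → Unique (t ∷ r ∷ L) →
    Any MB (r ∷ L) → Coloured d t → Coloured d r → ⊥
  first-step-recoloured {t = t} t∈MB p@(e ∷ᵖ _) (t∉ ∷ simple) hit t-col r-col
    with first-hit MB? p hit
  ... | y , [] , y∈MB , _ , _ , _ , refl = adjacent-MB-differ e t∈MB y∈MB t-col r-col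
  ... | y , s₀ ∷ s , y∈MB , s-free , _ ∷ᵖ q , _ , refl with path-init s q
  ...   | _ , inner , last-step = clash first-step-differs t-col r-col
    where
    t≢y : t ≢ y
    t≢y = All.lookup t∉ (∈-++⁺ʳ (s₀ ∷ s) (here refl))
    -- rule (3) for the path t, s₀, …, s, y whose interior avoids M ∪ B
    first-step-differs : DiffColour w φ t s₀
    first-step-differs = proj₁
      (proj₂ (proj₂ compatible) t y (length s) (lookup (s₀ ∷ s)) t∈MB y∈MB
        (lookup-injective (unique-++⁻ˡ (s₀ ∷ s) simple))
        (λ i → All.lookup s-free (∈-lookup i)) e (path-lookup-step inner)
        (subst (λ v → Edge T v y) (≡.sym (path-lookup-last inner)) last-step)
        (⊥-elim ∘ t≢y))

  -- A colour-d path from t ∈ M ∪ B to t₁ ≠ t, followed by an edge and a path of another colour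
  -- ending in M ∪ B, is a simple path whose first step keeps its colour: impossible.
  two-coloured-path : ∀ {d d′ t t₁ q₀ q₁} → MB t → ColouredPath d t t₁ → t ≢ t₁ →
    Edge T t₁ q₀ → ColouredPath d′ q₀ q₁ → d ≢ d′ → MB q₁ → ⊥
  two-coloured-path _ (colouredPath [] []ᵖ _ _) t≢t = ⊥-elim (t≢t refl)
  two-coloured-path t∈MB (colouredPath (r ∷ L) P P-simple P-col@(t-col ∷ r-col ∷ _)) _ link
                    (colouredPath M Q Q-simple Q-col) d≢d′ q₁∈MB =
    first-step-recoloured t∈MB (path-++ P link Q)
      (Unique.++⁺ P-simple Q-simple (colours-disjoint d≢d′ P-col Q-col))
      (lose (∈-++⁺ʳ (r ∷ L) (path-end-∈ Q)) q₁∈MB) t-col r-col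

  -- If a colour-d path a ⇝ b (a ≠ b), an edge b b′ and a colour-d′ path b′ ⇝ a′ are closed to
  -- a cycle by an edge a a′ of T, then that edge belongs to T_S: otherwise a, a′ ∈ M.
  closing-edge-in-tree : ∀ {d d′ a b a′ b′} → ColouredPath d a b → a ≢ b → Edge T b b′ →
    ColouredPath d′ b′ a′ → d ≢ d′ → Edge T a a′ → Edge TS a a′
  closing-edge-in-tree {a = a} {a′ = a′} P a≢b bb′ Q d≢d′ aa′ with adj TS a a′ in aa′∈TS
  ... | true  = refl
  ... | false = ⊥-elim (two-coloured-path (proj₁ ends∈M) P a≢b bb′ Q d≢d′ (proj₂ ends∈M))
    where
    ends∈M : MB a × MB a′
    ends∈M = non-tree-edge-in-M aa′ aa′∈TS

  -- Rule (2) forbids non-tree edges inside one colour, so monochromatic paths run in T_S.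
  monochromatic-path-in-tree : ∀ {d a b} (P : ColouredPath d a b) → Path (Edge TS) a b (vertices P)
  monochromatic-path-in-tree P with path-escape (λ x y → adj TS x y Bool.≟ true) (path P)
  ... | inj₁ P-in-TS = P-in-TS
  ... | inj₂ (x , y , x∈ , y∈ , e , ∉TS) =
    ⊥-elim (adjacent-MB-differ e (proj₁ ends∈M) (proj₂ ends∈M)
                                 (All.lookup (coloured P) x∈) (All.lookup (coloured P) y∈))
    where
    ends∈M : MB x × MB y
    ends∈M = non-tree-edge-in-M e (Bool.¬-not ∉TS)

  -- Two connected monochromatic sets S ∋ u, v and S′ ∋ u′, v′ of different colours, joined by
  -- edges u u′ and v v′, force W(u) = W(v): otherwise projected u ⇝ v and v′ ⇝ u′ paths and
  -- the two links form a cycle of T whose edges all lie in the tree T_S.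
  double-link-same-witness : ∀ {S S′ d d′ u v u′ v′} → IsTree TS →
    Connected G S → Monochromatic φ S d → Connected G S′ → Monochromatic φ S′ d′ → d ≢ d′ →
    u ∈ˢ S → v ∈ˢ S → u′ ∈ˢ S′ → v′ ∈ˢ S′ → Edge G u u′ → Edge G v v′ → w u ≡ w v
  double-link-same-witness {S} {S′} {d} {d′} {u} {v} {u′} {v′} TS-tree
    (_ , S-conn) S-mono (_ , S′-conn) S′-mono d≢d′ u∈S v∈S u′∈S′ v′∈S′ uu′ vv′ with w u ≟ w v
  ... | yes wu≡wv = wu≡wv
  ... | no wu≢wv  = ⊥-elim (proj₂ TS-tree cycle)
    where
    link : ∀ {x y} → x ∈ˢ S → y ∈ˢ S′ → Edge G x y → Edge T (w x) (w y)
    link {x} {y} x∈S y∈S′ e = recoloured-edge e (λ φx≡φy → d≢d′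
      (trans (≡.sym (S-mono x x∈S)) (trans φx≡φy (S′-mono y y∈S′))))
    P : ColouredPath d (w u) (w v)
    P = project (S-conn u v u∈S v∈S) S-mono
    Q : ColouredPath d′ (w v′) (w u′)
    Q = project (S′-conn v′ u′ v′∈S′ u′∈S′) S′-mono
    u-link : Edge TS (w u) (w u′)
    u-link = closing-edge-in-tree P wu≢wv (link v∈S v′∈S′ vv′) Q d≢d′ (link u∈S u′∈S′ uu′)
    v-link : Edge TS (w v) (w v′)
    v-link = closing-edge-in-tree (project (S-conn v u v∈S u∈S) S-mono) (λ eq → wu≢wv (≡.sym eq))
               (link u∈S u′∈S′ uu′) (project (S′-conn u′ v′ u′∈S′ v′∈S′) S′-mono) d≢d′
               (link v∈S v′∈S′ vv′)
    cycle : HasCycle TS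
    cycle = closed-path-cycle {H = TS}
      (path-++ (monochromatic-path-in-tree P) v-link (monochromatic-path-in-tree Q))
      (Unique.++⁺ (simple P) (simple Q) (colours-disjoint d≢d′ (coloured P) (coloured Q)))
      (extended-path-length (path P) wu≢wv) (edge-sym TS u-link)

-- If X = ⋃_{t ∈ A} W(t) lies inside the witness set W(w u) of one of its vertices u, then
-- A = {w u}: every t ∈ A has a nonempty witness set, whose vertices lie in X ⊆ W(w u).
single-witness-set : ∀ {nG nT} {G : Graph nG} {T : Graph nT} {w : Fin nG → Fin nT} {X A u} →
  WitnessStructure G T w → (∀ x → x ∈ˢ X ⇔ w x ∈ˢ A) → u ∈ˢ X → X ⊆ˢ fibre w (w u) →
  count A ≡ 1
single-witness-set {w = w} {X} {A} {u} WS X≡⋃A u∈X X⊆W =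
  count-singleton A (w u) (Equivalence.to (X≡⋃A u) u∈X) only
  where
  only : ∀ t → t ∈ˢ A → t ≡ w u
  only t t∈A with proj₁ (proj₁ WS t)
  ... | g , g∈W with Equivalence.to (fibre-⇔ w) g∈W
  ... | refl = Equivalence.to (fibre-⇔ w) (X⊆W g (Equivalence.from (X≡⋃A g) t∈A))

mainTheorem9 : ∀ (ℓ k nG nT : ℕ) (G : Graph nG) (T : Graph nT) →
    TwoConnected G → KContractible k G T → InTreeClass ℓ T →
    ∀ (w : Fin nG → Fin nT) → WitnessStructure G T w →
    ∀ (TS : Graph nT) → SpanningSub TS T → IsTree TS →
    ∀ (r : ℕ) → r * r ≤ 4 * ℓ → 4 * ℓ < suc r * suc r →
    ∀ (φ : Fin nG → Fin (2 + r)) → Compatible T TS w φ →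
    ∀ (X : VSet nG) → MonoComponent G φ X → 2 ≤ count X →
    ∀ (A : VSet nT) → (∀ x → x ∈ˢ X ⇔ w x ∈ˢ A) →
    ∀ (q : ℕ) (p : Fin (2 + q) → Fin nG) → IsInducedPath G X q p →
    (∀ (i : Fin q) → deg G (p (suc (inject₁ i))) ≡ 2) →
    (Σ (VSet nG) λ X′ → MonoComponent G φ X′ × ¬ (∀ x → X x ≡ X′ x) ×
       (∃ λ y → Edge G (p zero) y × y ∈ˢ X′) ×
       (∃ λ y → Edge G (p (fromℕ (suc q))) y × y ∈ˢ X′)) →
    count A ≡ 1
mainTheorem9 ℓ k nG nT G T _ _ _ w WS TS _ TS-tree r _ _ φ compatible
  X X-comp@(d , X-mono , X-conn , _) _ A X≡⋃A q p X-path _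
  (X′ , X′-comp@(d′ , X′-mono , X′-conn , _) , X≢X′ , (u′ , uu′ , u′∈X′) , (v′ , vv′ , v′∈X′)) =
  single-witness-set {T = T} WS X≡⋃A u∈X X⊆W[u]
  where
  open WitnessColouring {T = T} {TS = TS} WS compatible
  on-path : ∀ i → p i ∈ˢ X
  on-path i = Equivalence.from (proj₁ (proj₂ X-path) (p i)) (i , refl)
  u∈X : p zero ∈ˢ X
  u∈X = on-path zero
  v∈X : p (fromℕ (suc q)) ∈ˢ X
  v∈X = on-path (fromℕ (suc q))
  d≢d′ : d ≢ d′
  d≢d′ = adjacent-components-differ X-comp X′-comp X≢X′ u∈X u′∈X′ uu′
  W[u]≡W[v] : w (p zero) ≡ w (p (fromℕ (suc q)))
  W[u]≡W[v] = double-link-same-witness TS-tree X-conn X-mono X′-conn X′-mono d≢d′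
                u∈X v∈X u′∈X′ v′∈X′ uu′ vv′
  X⊆W[u] : X ⊆ˢ fibre w (w (p zero))
  X⊆W[u] = connected-through-ends X-path
    (witness-set-in-component {T = T} WS (proj₁ compatible) X-comp u∈X) (proj₁ WS (w (p zero)))
    (Equivalence.from (fibre-⇔ w {x = p zero}) refl)
    (Equivalence.from (fibre-⇔ w {x = p (fromℕ (suc q))}) (≡.sym W[u]≡W[v]))
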